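{- Let $q$ and $\gamma$ be positive integers and let $\beta$ be an integer with $0\leq \beta<2^{q^2}$. Then $$\alpha\bigl(2^{3q^2}+\gamma \cdot 2^{q^2}+\beta\bigr)\leq \alpha\bigl(2^{3q^2}+\beta\bigr)+ \alpha(\gamma)+1.$$
   Context: For a finite family $\mathcal{S}=\{S_1,\dots,S_t\}$ of finite sets, $\mathbf{ID}(\mathcal{S})=2^{S_1}\cup\cdots\cup 2^{S_t}$ (all sets contained in some member of $\mathcal{S}$). For a positive integer $k$, $\alpha(k)$ is the minimum of $|\mathcal{S}|$ over all finite families $\mathcal{S}$ of finite sets with $|\mathbf{ID}(\mathcal{S})|=k$. -}

module Defs where

open import Data.Nat using (ℕ; zero; suc; _≤_)
open import Data.Bool using (true; false)
open import Data.Vec using (_∷_; [])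
open import Data.List using (List; []; _∷_; map; _++_; length; filter)
open import Data.List.Relation.Unary.Any using (any?)
open import Data.List.Relation.Unary.Unique.Propositional using (Unique)
open import Data.Product using (Σ; _×_)
open import Data.Fin.Subset using (Subset; _⊆_)
open import Data.Fin.Subset.Properties using (_⊆?_)
open import Relation.Binary.PropositionalEquality using (_≡_)

allSubsets : (n : ℕ) → List (Subset n)
allSubsets zero    = [] ∷ []
allSubsets (suc n) = map (false ∷_) (allSubsets n) ++ map (true ∷_) (allSubsets n)

idCount : {n : ℕ} → List (Subset n) → ℕ
idCount {n} S = length (filter (λ T → any? (λ Si → T ⊆? Si) S) (allSubsets n))

-- Achieves k m : there is a family S of m distinct finite sets with |ID(S)| = k.
-- (Finite sets are taken WLOG inside a finite ground set Fin n.)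
Achieves : ℕ → ℕ → Set
Achieves k m = Σ ℕ λ n → Σ (List (Subset n)) λ S →
  Unique S × length S ≡ m × idCount S ≡ k

-- IsAlpha k a : a = α(k), i.e. a is the minimum of |S| over families with |ID(S)| = k.
IsAlpha : ℕ → ℕ → Set
IsAlpha k a = Achieves k a × ((m : ℕ) → Achieves k m → a ≤ m)

-- α(k + 2^p·g) ≤ α(k) + α(g) + 1 for k, g, p ≥ 1: put an optimal family for k on one block of
-- fresh points and an optimal family for g, each member enlarged by a common p-element block, on
-- another. The ideals multiply (2^p·g subsets on the second side) and meet only in ∅, and one
-- extra singleton on a new point makes up for the ∅ counted twice. The theorem is the case
-- k = 2^(3q²) + β, p = q².
module Submission where

open import Defs
open import Data.Bool using (Bool; true; false; _∧_; _∨_)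
open import Data.Bool.Properties
  using (∧-commutativeMonoid; ∧-comm; ∧-assoc; ∧-zeroʳ; ∨-identityʳ; ∧-distribˡ-∨; ∧-distribʳ-∨; ∨-assoc)
open import Data.Fin.Subset using (Subset; ⊥; ⊤; inside; outside)
open import Data.Fin.Subset.Properties using (_⊆?_; ⊥⊆; ⊆⊤; ⊆-antisym)
open import Data.List using (List; []; _∷_; map; _++_; length; filter)
open import Data.List.Properties using (length-++; length-map; map-++; map-∘)
open import Data.List.Membership.Propositional.Properties using (∈-map⁻)
open import Data.List.Relation.Binary.Disjoint.Propositional using (Disjoint)
import Data.List.Relation.Unary.All as All
import Data.List.Relation.Unary.All.Properties as All
open import Data.List.Relation.Unary.AllPairs using (_∷_)
open import Data.List.Relation.Unary.Any using (any?)
open import Data.List.Relation.Unary.Unique.Propositional using (Unique)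
open import Data.List.Relation.Unary.Unique.Propositional.Properties using (++⁺; map⁺)
open import Data.Nat using (ℕ; zero; suc; _+_; _*_; _^_; _≤_; _<_)
open import Data.Nat.ListAction using (sum)
open import Data.Nat.ListAction.Properties using (sum-++)
open import Data.Nat.Properties
  using (+-commutativeSemigroup; +-comm; +-identityʳ; *-identityˡ; *-identityʳ; *-comm; *-distribˡ-+; m^n>0; m≤m+n; ≤-trans)
open import Data.Product using (_,_)
open import Data.Vec using (Vec; []; _∷_) renaming (_++_ to _++ᵛ_)
open import Data.Vec.Properties using (∷-injectiveʳ; ++-injectiveˡ; ++-injectiveʳ)
open import Function using (_∘_)
open import Relation.Nullary using (does; yes)
open import Relation.Nullary.Decidable using (dec-true)
open import Relation.Binary.PropositionalEquality
  using (_≡_; _≢_; refl; sym; trans; cong; cong₂; subst; module ≡-Reasoning)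
open import Relation.Unary using (Decidable)

import Algebra.Properties.CommutativeSemigroup as CommSemigroupProperties
open import Algebra.Bundles using (CommutativeMonoid)

open CommSemigroupProperties +-commutativeSemigroup using ()
  renaming (interchange to +-interchange; xy∙z≈xz∙y to +-rightComm)
open CommSemigroupProperties (CommutativeMonoid.commutativeSemigroup ∧-commutativeMonoid) using ()
  renaming (interchange to ∧-interchange)
open ≡-Reasoning

private
  variable
    m n : ℕ

toℕ : Bool → ℕ
toℕ true  = 1
toℕ false = 0

toℕ-∧ : ∀ a b → toℕ (a ∧ b) ≡ toℕ a * toℕ b
toℕ-∧ true  b = sym (*-identityˡ (toℕ b))
toℕ-∧ false b = refl

toℕ-∨+∧ : ∀ a b → toℕ (a ∨ b) + toℕ (a ∧ b) ≡ toℕ a + toℕ b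
toℕ-∨+∧ true  true  = refl
toℕ-∨+∧ true  false = refl
toℕ-∨+∧ false true  = refl
toℕ-∨+∧ false false = refl

sumSubsets : (n : ℕ) → (Subset n → ℕ) → ℕ
sumSubsets zero    f = f []
sumSubsets (suc n) f = sumSubsets n (f ∘ (outside ∷_)) + sumSubsets n (f ∘ (inside ∷_))

sumSubsets-cong : ∀ n {f g : Subset n → ℕ} → (∀ x → f x ≡ g x) → sumSubsets n f ≡ sumSubsets n g
sumSubsets-cong zero    f≗g = f≗g []
sumSubsets-cong (suc n) f≗g =
  cong₂ _+_ (sumSubsets-cong n (f≗g ∘ (outside ∷_))) (sumSubsets-cong n (f≗g ∘ (inside ∷_)))

sumSubsets-+ : ∀ n (f g : Subset n → ℕ) →
  sumSubsets n (λ x → f x + g x) ≡ sumSubsets n f + sumSubsets n g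
sumSubsets-+ zero    f g = refl
sumSubsets-+ (suc n) f g = begin
  sumSubsets n (λ x → f (outside ∷ x) + g (outside ∷ x))
    + sumSubsets n (λ x → f (inside ∷ x) + g (inside ∷ x))
    ≡⟨ cong₂ _+_ (sumSubsets-+ n _ _) (sumSubsets-+ n _ _) ⟩
  (sumSubsets n (f ∘ (outside ∷_)) + sumSubsets n (g ∘ (outside ∷_)))
    + (sumSubsets n (f ∘ (inside ∷_)) + sumSubsets n (g ∘ (inside ∷_)))
    ≡⟨ +-interchange (sumSubsets n (f ∘ (outside ∷_))) (sumSubsets n (g ∘ (outside ∷_))) _ _ ⟩
  sumSubsets (suc n) f + sumSubsets (suc n) g ∎

sumSubsets-*ˡ : ∀ n c (f : Subset n → ℕ) → sumSubsets n (λ x → c * f x) ≡ c * sumSubsets n f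
sumSubsets-*ˡ zero    c f = refl
sumSubsets-*ˡ (suc n) c f =
  trans (cong₂ _+_ (sumSubsets-*ˡ n c _) (sumSubsets-*ˡ n c _)) (sym (*-distribˡ-+ c _ _))

sumSubsets-++ : ∀ m n (f : Subset (m + n) → ℕ) →
  sumSubsets (m + n) f ≡ sumSubsets m (λ u → sumSubsets n (λ v → f (u ++ᵛ v)))
sumSubsets-++ zero    n f = refl
sumSubsets-++ (suc m) n f =
  cong₂ _+_ (sumSubsets-++ m n (f ∘ (outside ∷_))) (sumSubsets-++ m n (f ∘ (inside ∷_)))

sum-map-allSubsets : ∀ n (f : Subset n → ℕ) → sum (map f (allSubsets n)) ≡ sumSubsets n f
sum-map-allSubsets zero    f = +-identityʳ (f [])
sum-map-allSubsets (suc n) f = begin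
  sum (map f (map (outside ∷_) (allSubsets n) ++ map (inside ∷_) (allSubsets n)))
    ≡⟨ cong sum (map-++ f (map (outside ∷_) (allSubsets n)) _) ⟩
  sum (map f (map (outside ∷_) (allSubsets n)) ++ map f (map (inside ∷_) (allSubsets n)))
    ≡⟨ sum-++ (map f (map (outside ∷_) (allSubsets n))) _ ⟩
  sum (map f (map (outside ∷_) (allSubsets n))) + sum (map f (map (inside ∷_) (allSubsets n)))
    ≡⟨ cong₂ _+_ (cong sum (sym (map-∘ (allSubsets n)))) (cong sum (sym (map-∘ (allSubsets n)))) ⟩
  sum (map (f ∘ (outside ∷_)) (allSubsets n)) + sum (map (f ∘ (inside ∷_)) (allSubsets n))
    ≡⟨ cong₂ _+_ (sum-map-allSubsets n _) (sum-map-allSubsets n _) ⟩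
  sumSubsets (suc n) f ∎

count : (n : ℕ) → (Subset n → Bool) → ℕ
count n P = sumSubsets n (toℕ ∘ P)

count-cong : ∀ n {P Q : Subset n → Bool} → (∀ x → P x ≡ Q x) → count n P ≡ count n Q
count-cong n P≗Q = sumSubsets-cong n (cong toℕ ∘ P≗Q)

count-false : ∀ n → count n (λ _ → false) ≡ 0
count-false zero    = refl
count-false (suc n) = cong₂ _+_ (count-false n) (count-false n)

count-∨+∧ : ∀ n (P Q : Subset n → Bool) →
  count n (λ x → P x ∨ Q x) + count n (λ x → P x ∧ Q x) ≡ count n P + count n Q
count-∨+∧ n P Q = begin
  count n (λ x → P x ∨ Q x) + count n (λ x → P x ∧ Q x)
    ≡⟨ sym (sumSubsets-+ n _ _) ⟩
  sumSubsets n (λ x → toℕ (P x ∨ Q x) + toℕ (P x ∧ Q x))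
    ≡⟨ sumSubsets-cong n (λ x → toℕ-∨+∧ (P x) (Q x)) ⟩
  sumSubsets n (λ x → toℕ (P x) + toℕ (Q x))
    ≡⟨ sumSubsets-+ n _ _ ⟩
  count n P + count n Q ∎

count-++ : ∀ m n {R : Subset (m + n) → Bool} (P : Subset m → Bool) (Q : Subset n → Bool) →
  (∀ u v → R (u ++ᵛ v) ≡ P u ∧ Q v) → count (m + n) R ≡ count m P * count n Q
count-++ m n {R} P Q R≗P∧Q = begin
  count (m + n) R
    ≡⟨ sumSubsets-++ m n _ ⟩
  sumSubsets m (λ u → sumSubsets n (λ v → toℕ (R (u ++ᵛ v))))
    ≡⟨ sumSubsets-cong m (λ u → sumSubsets-cong n (λ v → trans (cong toℕ (R≗P∧Q u v)) (toℕ-∧ (P u) (Q v)))) ⟩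
  sumSubsets m (λ u → sumSubsets n (λ v → toℕ (P u) * toℕ (Q v)))
    ≡⟨ sumSubsets-cong m (λ u → trans (sumSubsets-*ˡ n (toℕ (P u)) _) (*-comm (toℕ (P u)) _)) ⟩
  sumSubsets m (λ u → count n Q * toℕ (P u))
    ≡⟨ sumSubsets-*ˡ m (count n Q) _ ⟩
  count n Q * count m P
    ≡⟨ *-comm (count n Q) _ ⟩
  count m P * count n Q ∎

length-filter≡sum : {A : Set} {P : A → Set} (P? : Decidable P) (xs : List A) →
  length (filter P? xs) ≡ sum (map (toℕ ∘ does ∘ P?) xs)
length-filter≡sum P? []       = refl
length-filter≡sum P? (x ∷ xs) with does (P? x)
... | true  = cong suc (length-filter≡sum P? xs)
... | false = length-filter≡sum P? xs

_⊆ᵇ_ : Subset n → Subset n → Bool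
x ⊆ᵇ y = does (x ⊆? y)

_∈ᴵ_ : Subset n → List (Subset n) → Bool
x ∈ᴵ S = does (any? (x ⊆?_) S)

idCount≡count : (S : List (Subset n)) → idCount S ≡ count n (_∈ᴵ S)
idCount≡count {n} S =
  trans (length-filter≡sum (λ x → any? (x ⊆?_) S) (allSubsets n)) (sum-map-allSubsets n _)

⊆ᵇ-++ : ∀ (u a : Subset m) (v b : Subset n) → (u ++ᵛ v) ⊆ᵇ (a ++ᵛ b) ≡ u ⊆ᵇ a ∧ v ⊆ᵇ b
⊆ᵇ-++ []            []            v b = refl
⊆ᵇ-++ (outside ∷ u) (_ ∷ a)       v b = ⊆ᵇ-++ u a v b
⊆ᵇ-++ (inside ∷ u)  (outside ∷ a) v b = refl
⊆ᵇ-++ (inside ∷ u)  (inside ∷ a)  v b = ⊆ᵇ-++ u a v b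

⊆ᵇ-⊤ : (x : Subset n) → x ⊆ᵇ ⊤ ≡ true
⊆ᵇ-⊤ x = dec-true (x ⊆? ⊤) ⊆⊤

⊆ᵇ⊥⇒≡⊥ : (x : Subset n) → x ⊆ᵇ ⊥ ≡ true → x ≡ ⊥
⊆ᵇ⊥⇒≡⊥ x x⊆ᵇ⊥ with x ⊆? ⊥
... | yes x⊆⊥ = ⊆-antisym x⊆⊥ ⊥⊆

⊆ᵇ⊥⇒holds : {P : Subset n → Bool} → P ⊥ ≡ true → ∀ x → x ⊆ᵇ ⊥ ≡ true → P x ≡ true
⊆ᵇ⊥⇒holds {P = P} P⊥ x x⊆ᵇ⊥ = subst (λ y → P y ≡ true) (sym (⊆ᵇ⊥⇒≡⊥ x x⊆ᵇ⊥)) P⊥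

⊆ᵇ⊥-∧ : {P : Subset n → Bool} → P ⊥ ≡ true → ∀ x → x ⊆ᵇ ⊥ ∧ P x ≡ x ⊆ᵇ ⊥
⊆ᵇ⊥-∧ P⊥ x with x ⊆ᵇ ⊥ in x⊆ᵇ⊥
... | true  = ⊆ᵇ⊥⇒holds P⊥ x x⊆ᵇ⊥
... | false = refl

⊆ᵇ⊥-∨ : {P : Subset n → Bool} → P ⊥ ≡ true → ∀ x → x ⊆ᵇ ⊥ ∨ P x ≡ P x
⊆ᵇ⊥-∨ P⊥ x with x ⊆ᵇ ⊥ in x⊆ᵇ⊥
... | true  = sym (⊆ᵇ⊥⇒holds P⊥ x x⊆ᵇ⊥)
... | false = refl

count-⊆⊤ : ∀ n → count n (_⊆ᵇ ⊤) ≡ 2 ^ n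
count-⊆⊤ zero    = refl
count-⊆⊤ (suc n) = trans (cong₂ _+_ (count-⊆⊤ n) (count-⊆⊤ n)) (cong (2 ^ n +_) (sym (+-identityʳ (2 ^ n))))

count-⊆⊥ : ∀ n → count n (_⊆ᵇ ⊥) ≡ 1
count-⊆⊥ zero    = refl
count-⊆⊥ (suc n) = cong₂ _+_ (count-⊆⊥ n) (count-false n)

count-⊆⊥-∧ : ∀ n {P : Subset n → Bool} → P ⊥ ≡ true → count n (λ x → x ⊆ᵇ ⊥ ∧ P x) ≡ 1
count-⊆⊥-∧ n P⊥ = trans (count-cong n (⊆ᵇ⊥-∧ P⊥)) (count-⊆⊥ n)

⊥∈ᴵ-∷ : (s : Subset n) (S : List (Subset n)) → ⊥ ∈ᴵ (s ∷ S) ≡ true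
⊥∈ᴵ-∷ s S = cong (_∨ ⊥ ∈ᴵ S) (dec-true (⊥ ⊆? s) ⊥⊆)

∈ᴵ-++ : (x : Subset n) (A B : List (Subset n)) → x ∈ᴵ (A ++ B) ≡ x ∈ᴵ A ∨ x ∈ᴵ B
∈ᴵ-++ x []      B = refl
∈ᴵ-++ x (a ∷ A) B = trans (cong (x ⊆ᵇ a ∨_) (∈ᴵ-++ x A B)) (sym (∨-assoc (x ⊆ᵇ a) _ _))

∈ᴵ-map-++ˡ : (a u : Subset m) (S : List (Subset n)) (w : Subset n) →
  (u ++ᵛ w) ∈ᴵ map (a ++ᵛ_) S ≡ u ⊆ᵇ a ∧ w ∈ᴵ S
∈ᴵ-map-++ˡ a u []      w = sym (∧-zeroʳ (u ⊆ᵇ a))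
∈ᴵ-map-++ˡ a u (s ∷ S) w = begin
  (u ++ᵛ w) ⊆ᵇ (a ++ᵛ s) ∨ (u ++ᵛ w) ∈ᴵ map (a ++ᵛ_) S
    ≡⟨ cong₂ _∨_ (⊆ᵇ-++ u a w s) (∈ᴵ-map-++ˡ a u S w) ⟩
  u ⊆ᵇ a ∧ w ⊆ᵇ s ∨ u ⊆ᵇ a ∧ w ∈ᴵ S
    ≡⟨ sym (∧-distribˡ-∨ (u ⊆ᵇ a) _ _) ⟩
  u ⊆ᵇ a ∧ w ∈ᴵ (s ∷ S) ∎

∈ᴵ-map-++ʳ : (a u : Subset m) (S : List (Subset n)) (w : Subset n) →
  (w ++ᵛ u) ∈ᴵ map (_++ᵛ a) S ≡ w ∈ᴵ S ∧ u ⊆ᵇ a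
∈ᴵ-map-++ʳ a u []      w = refl
∈ᴵ-map-++ʳ a u (s ∷ S) w = begin
  (w ++ᵛ u) ⊆ᵇ (s ++ᵛ a) ∨ (w ++ᵛ u) ∈ᴵ map (_++ᵛ a) S
    ≡⟨ cong₂ _∨_ (⊆ᵇ-++ w s u a) (∈ᴵ-map-++ʳ a u S w) ⟩
  w ⊆ᵇ s ∧ u ⊆ᵇ a ∨ w ∈ᴵ S ∧ u ⊆ᵇ a
    ≡⟨ sym (∧-distribʳ-∨ (u ⊆ᵇ a) (w ⊆ᵇ s) (w ∈ᴵ S)) ⟩
  w ∈ᴵ (s ∷ S) ∧ u ⊆ᵇ a ∎

count-∈ᴵ-map-++ˡ : ∀ m n (a : Subset m) (S : List (Subset n)) →
  count (m + n) (_∈ᴵ map (a ++ᵛ_) S) ≡ count m (_⊆ᵇ a) * count n (_∈ᴵ S)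
count-∈ᴵ-map-++ˡ m n a S = count-++ m n (_⊆ᵇ a) (_∈ᴵ S) (λ u w → ∈ᴵ-map-++ˡ a u S w)

count-∈ᴵ-map-++ʳ : ∀ m n (a : Subset m) (S : List (Subset n)) →
  count (n + m) (_∈ᴵ map (_++ᵛ a) S) ≡ count n (_∈ᴵ S) * count m (_⊆ᵇ a)
count-∈ᴵ-map-++ʳ m n a S = count-++ n m (_∈ᴵ S) (_⊆ᵇ a) (λ w u → ∈ᴵ-map-++ʳ a u S w)

∈ᴵ-map-∷ : (b c : Bool) (y : Subset n) (G : List (Subset n)) →
  (b ∷ y) ∈ᴵ map (c ∷_) G ≡ (b ∷ []) ⊆ᵇ (c ∷ []) ∧ y ∈ᴵ G
∈ᴵ-map-∷ b c y G = ∈ᴵ-map-++ˡ (c ∷ []) (b ∷ []) G y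

count-∈ᴵ-addPoint : (G : List (Subset n)) → ⊥ ∈ᴵ G ≡ true →
  count (suc n) (_∈ᴵ ((inside ∷ ⊥) ∷ map (outside ∷_) G)) ≡ count n (_∈ᴵ G) + 1
count-∈ᴵ-addPoint {n} G ⊥∈G = cong₂ _+_
  (count-cong n (λ y → trans (cong (y ⊆ᵇ ⊥ ∨_) (∈ᴵ-map-∷ outside outside y G)) (⊆ᵇ⊥-∨ ⊥∈G y)))
  (trans (count-cong n (λ y → trans (cong (y ⊆ᵇ ⊥ ∨_) (∈ᴵ-map-∷ inside outside y G)) (∨-identityʳ (y ⊆ᵇ ⊥))))
         (count-⊆⊥ n))

count-∈ᴵ-++ : ∀ n (A B : List (Subset n)) →
  count n (_∈ᴵ (A ++ B)) + count n (λ x → x ∈ᴵ A ∧ x ∈ᴵ B) ≡ count n (_∈ᴵ A) + count n (_∈ᴵ B)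
count-∈ᴵ-++ n A B =
  trans (cong (_+ count n (λ x → x ∈ᴵ A ∧ x ∈ᴵ B)) (count-cong n (λ x → ∈ᴵ-++ x A B)))
        (count-∨+∧ n (_∈ᴵ A) (_∈ᴵ B))

⊥∈ᴵ-idCount : (S : List (Subset n)) → 1 ≤ idCount S → ⊥ ∈ᴵ S ≡ true
⊥∈ᴵ-idCount {n} []      1≤id with () ← subst (1 ≤_) (trans (idCount≡count {n} []) (count-false n)) 1≤id
⊥∈ᴵ-idCount     (s ∷ S) _    = ⊥∈ᴵ-∷ s S

⊥∈ᴵ-map : (f : Subset m → Subset n) (S : List (Subset m)) → ⊥ ∈ᴵ S ≡ true → ⊥ ∈ᴵ map f S ≡ true
⊥∈ᴵ-map f (s ∷ S) _ = ⊥∈ᴵ-∷ (f s) (map f S)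

map-++ᵛ-disjoint : {A : Set} {a b : Vec A m} {X Y : List (Vec A n)} →
  a ≢ b → Disjoint (map (a ++ᵛ_) X) (map (b ++ᵛ_) Y)
map-++ᵛ-disjoint {a = a} {b} a≢b (x∈ , y∈) with ∈-map⁻ (a ++ᵛ_) x∈ | ∈-map⁻ (b ++ᵛ_) y∈
... | _ , _ , refl | _ , _ , eq = a≢b (++-injectiveˡ a b eq)

-- Coordinates: one new point, then p points, then the ground sets of T and of S.
module Glue (p : ℕ) {nS nT : ℕ} (S : List (Subset nS)) (T : List (Subset nT)) where

  S⁺ : List (Subset (p + (nT + nS)))
  S⁺ = map (⊥ {p} ++ᵛ_) (map (⊥ {nT} ++ᵛ_) S)

  T⁺ : List (Subset (p + (nT + nS)))
  T⁺ = map (⊤ {p} ++ᵛ_) (map (_++ᵛ ⊥ {nS}) T)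

  glued : List (Subset (suc (p + (nT + nS))))
  glued = (inside ∷ ⊥) ∷ map (outside ∷_) (S⁺ ++ T⁺)

  count-S⁺ : count (p + (nT + nS)) (_∈ᴵ S⁺) ≡ count nS (_∈ᴵ S)
  count-S⁺ = begin
    count (p + (nT + nS)) (_∈ᴵ S⁺)
      ≡⟨ count-∈ᴵ-map-++ˡ p (nT + nS) ⊥ (map (⊥ {nT} ++ᵛ_) S) ⟩
    count p (_⊆ᵇ ⊥) * count (nT + nS) (_∈ᴵ map (⊥ ++ᵛ_) S)
      ≡⟨ cong₂ _*_ (count-⊆⊥ p) (count-∈ᴵ-map-++ˡ nT nS ⊥ S) ⟩
    1 * (count nT (_⊆ᵇ ⊥) * count nS (_∈ᴵ S))
      ≡⟨ cong (λ c → 1 * (c * count nS (_∈ᴵ S))) (count-⊆⊥ nT) ⟩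
    1 * (1 * count nS (_∈ᴵ S))
      ≡⟨ trans (*-identityˡ _) (*-identityˡ _) ⟩
    count nS (_∈ᴵ S) ∎

  count-T⁺ : count (p + (nT + nS)) (_∈ᴵ T⁺) ≡ 2 ^ p * count nT (_∈ᴵ T)
  count-T⁺ = begin
    count (p + (nT + nS)) (_∈ᴵ T⁺)
      ≡⟨ count-∈ᴵ-map-++ˡ p (nT + nS) ⊤ (map (_++ᵛ ⊥ {nS}) T) ⟩
    count p (_⊆ᵇ ⊤) * count (nT + nS) (_∈ᴵ map (_++ᵛ ⊥) T)
      ≡⟨ cong₂ _*_ (count-⊆⊤ p) (count-∈ᴵ-map-++ʳ nS nT ⊥ T) ⟩
    2 ^ p * (count nT (_∈ᴵ T) * count nS (_⊆ᵇ ⊥))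
      ≡⟨ cong (λ c → 2 ^ p * (count nT (_∈ᴵ T) * c)) (count-⊆⊥ nS) ⟩
    2 ^ p * (count nT (_∈ᴵ T) * 1)
      ≡⟨ cong (2 ^ p *_) (*-identityʳ _) ⟩
    2 ^ p * count nT (_∈ᴵ T) ∎

  count-S⁺∩T⁺ : ⊥ ∈ᴵ S ≡ true → ⊥ ∈ᴵ T ≡ true →
    count (p + (nT + nS)) (λ x → x ∈ᴵ S⁺ ∧ x ∈ᴵ T⁺) ≡ 1
  count-S⁺∩T⁺ ⊥∈S ⊥∈T =
    trans (count-++ p (nT + nS) (_⊆ᵇ ⊥) (λ r → r ∈ᴵ S₁ ∧ r ∈ᴵ T₁) split-p)
          (cong₂ _*_ (count-⊆⊥ p)
            (trans (count-++ nT nS (λ v → v ⊆ᵇ ⊥ ∧ v ∈ᴵ T) (λ w → w ∈ᴵ S ∧ w ⊆ᵇ ⊥) split-TS)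
                   (cong₂ _*_ (count-⊆⊥-∧ nT ⊥∈T)
                              (trans (count-cong nS (λ w → ∧-comm (w ∈ᴵ S) _)) (count-⊆⊥-∧ nS ⊥∈S)))))
    where
    S₁ = map (⊥ {nT} ++ᵛ_) S
    T₁ = map (_++ᵛ ⊥ {nS}) T

    split-p : ∀ u r → (u ++ᵛ r) ∈ᴵ S⁺ ∧ (u ++ᵛ r) ∈ᴵ T⁺ ≡ u ⊆ᵇ ⊥ ∧ (r ∈ᴵ S₁ ∧ r ∈ᴵ T₁)
    split-p u r = begin
      (u ++ᵛ r) ∈ᴵ S⁺ ∧ (u ++ᵛ r) ∈ᴵ T⁺
        ≡⟨ cong₂ _∧_ (∈ᴵ-map-++ˡ ⊥ u S₁ r) (∈ᴵ-map-++ˡ ⊤ u T₁ r) ⟩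
      (u ⊆ᵇ ⊥ ∧ r ∈ᴵ S₁) ∧ (u ⊆ᵇ ⊤ ∧ r ∈ᴵ T₁)
        ≡⟨ cong (λ b → (u ⊆ᵇ ⊥ ∧ r ∈ᴵ S₁) ∧ (b ∧ r ∈ᴵ T₁)) (⊆ᵇ-⊤ u) ⟩
      (u ⊆ᵇ ⊥ ∧ r ∈ᴵ S₁) ∧ r ∈ᴵ T₁
        ≡⟨ ∧-assoc (u ⊆ᵇ ⊥) _ _ ⟩
      u ⊆ᵇ ⊥ ∧ (r ∈ᴵ S₁ ∧ r ∈ᴵ T₁) ∎

    split-TS : ∀ v w → (v ++ᵛ w) ∈ᴵ S₁ ∧ (v ++ᵛ w) ∈ᴵ T₁ ≡ (v ⊆ᵇ ⊥ ∧ v ∈ᴵ T) ∧ (w ∈ᴵ S ∧ w ⊆ᵇ ⊥)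
    split-TS v w = trans (cong₂ _∧_ (∈ᴵ-map-++ˡ ⊥ v S w) (∈ᴵ-map-++ʳ ⊥ w T v))
                         (∧-interchange (v ⊆ᵇ ⊥) (w ∈ᴵ S) (v ∈ᴵ T) (w ⊆ᵇ ⊥))

  count-glued : ⊥ ∈ᴵ S ≡ true → ⊥ ∈ᴵ T ≡ true →
    count (suc (p + (nT + nS))) (_∈ᴵ glued) ≡ count nS (_∈ᴵ S) + 2 ^ p * count nT (_∈ᴵ T)
  count-glued ⊥∈S ⊥∈T = begin
    count (suc N) (_∈ᴵ glued)
      ≡⟨ count-∈ᴵ-addPoint (S⁺ ++ T⁺) (trans (∈ᴵ-++ ⊥ S⁺ T⁺) (cong (_∨ ⊥ ∈ᴵ T⁺) ⊥∈S⁺)) ⟩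
    count N (_∈ᴵ (S⁺ ++ T⁺)) + 1
      ≡⟨ cong (count N (_∈ᴵ (S⁺ ++ T⁺)) +_) (sym (count-S⁺∩T⁺ ⊥∈S ⊥∈T)) ⟩
    count N (_∈ᴵ (S⁺ ++ T⁺)) + count N (λ x → x ∈ᴵ S⁺ ∧ x ∈ᴵ T⁺)
      ≡⟨ count-∈ᴵ-++ N S⁺ T⁺ ⟩
    count N (_∈ᴵ S⁺) + count N (_∈ᴵ T⁺)
      ≡⟨ cong₂ _+_ count-S⁺ count-T⁺ ⟩
    count nS (_∈ᴵ S) + 2 ^ p * count nT (_∈ᴵ T) ∎
    where
    N = p + (nT + nS)
    ⊥∈S⁺ : ⊥ ∈ᴵ S⁺ ≡ true
    ⊥∈S⁺ = ⊥∈ᴵ-map (⊥ {p} ++ᵛ_) (map (⊥ {nT} ++ᵛ_) S) (⊥∈ᴵ-map (⊥ {nT} ++ᵛ_) S ⊥∈S)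

  length-glued : length glued ≡ length S + length T + 1
  length-glued = begin
    suc (length (map (outside ∷_) (S⁺ ++ T⁺)))
      ≡⟨ cong suc (trans (length-map _ (S⁺ ++ T⁺)) (length-++ S⁺)) ⟩
    suc (length S⁺ + length T⁺)
      ≡⟨ cong suc (cong₂ _+_ (trans (length-map _ (map (⊥ {nT} ++ᵛ_) S)) (length-map _ S))
                          (trans (length-map _ (map (_++ᵛ ⊥ {nS}) T)) (length-map _ T))) ⟩
    suc (length S + length T)
      ≡⟨ +-comm 1 _ ⟩
    length S + length T + 1 ∎

  unique-glued : ⊥ {p} ≢ ⊤ → Unique S → Unique T → Unique glued
  unique-glued ⊥≢⊤ uS uT =
    All.map⁺ (All.universal (λ _ ()) (S⁺ ++ T⁺))
    ∷ map⁺ ∷-injectiveʳ (++⁺ uS⁺ uT⁺ (map-++ᵛ-disjoint ⊥≢⊤))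
    where
    uS⁺ : Unique S⁺
    uS⁺ = map⁺ (++-injectiveʳ ⊥ ⊥) (map⁺ (++-injectiveʳ ⊥ ⊥) uS)
    uT⁺ : Unique T⁺
    uT⁺ = map⁺ (++-injectiveʳ ⊤ ⊤) (map⁺ (++-injectiveˡ _ _) uT)

achieves-glued : ∀ p {k g m c} → 1 ≤ k → 1 ≤ g → Achieves k m → Achieves g c →
  Achieves (k + 2 ^ suc p * g) (m + c + 1)
achieves-glued p 1≤k 1≤g (nS , S , uS , refl , refl) (nT , T , uT , refl , refl) =
  suc (suc p + (nT + nS)) , glued , unique-glued (λ ()) uS uT , length-glued , idCount-glued
  where
  open Glue (suc p) S T
  idCount-glued : idCount glued ≡ idCount S + 2 ^ suc p * idCount T
  idCount-glued = begin
    idCount glued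
      ≡⟨ idCount≡count glued ⟩
    count _ (_∈ᴵ glued)
      ≡⟨ count-glued (⊥∈ᴵ-idCount S 1≤k) (⊥∈ᴵ-idCount T 1≤g) ⟩
    count nS (_∈ᴵ S) + 2 ^ suc p * count nT (_∈ᴵ T)
      ≡⟨ sym (cong₂ (λ a b → a + 2 ^ suc p * b) (idCount≡count S) (idCount≡count T)) ⟩
    idCount S + 2 ^ suc p * idCount T ∎

lemma23 : (q γ β : ℕ) → 1 ≤ q → 1 ≤ γ → β < 2 ^ (q * q) →
    (a b c : ℕ) →
    IsAlpha (2 ^ (3 * (q * q)) + γ * 2 ^ (q * q) + β) a →
    IsAlpha (2 ^ (3 * (q * q)) + β) b →
    IsAlpha γ c →
    a ≤ b + c + 1
lemma23 q@(suc q′) γ β _ 1≤γ _ a b c (_ , a-minimal) (b-achieved , _) (c-achieved , _) =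
  a-minimal (b + c + 1)
    (subst (λ k → Achieves k (b + c + 1)) reorder
      (achieves-glued (q′ + q′ * q) (≤-trans (m^n>0 2 (3 * (q * q))) (m≤m+n _ β)) 1≤γ b-achieved c-achieved))
  where
  reorder : 2 ^ (3 * (q * q)) + β + 2 ^ (q * q) * γ ≡ 2 ^ (3 * (q * q)) + γ * 2 ^ (q * q) + β
  reorder = trans (+-rightComm (2 ^ (3 * (q * q))) β (2 ^ (q * q) * γ))
                  (cong (λ x → 2 ^ (3 * (q * q)) + x + β) (*-comm (2 ^ (q * q)) γ))
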